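{- A subset $T\subseteq X$ is a generalised nice set if and only if (i) $T$ is a nice set, and (ii) there are no $i,j\in I$ with $j\neq i$ such that $\{i,j\}\in T$ and $\{i,i*j\}\in T$.
   Context: Let $I=\{1,\dots,7\}$ and $I_0=I\cup\{0\}$. The Fano plane on $I$ has the seven lines $\{1,2,5\},\{5,6,7\},\{1,4,7\},\{1,3,6\},\{2,4,6\},\{2,3,7\},\{3,4,5\}$. For distinct $i,j\in I$, $i*j$ is the third point of the unique line containing $i$ and $j$. The operation is extended to $I_0$ by $0*i=i*0=i$ and $i*i=0$ for all $i\in I_0$. Three pairwise distinct $i,j,k\in I$ are generative if $k\neq i*j$. Let $X_0$ be the set of unordered pairs $\{i,j\}$ with $i,j\in I_0$, where $i=j$ is allowed, and $X=\{\{i,j\}:i,j\in I,\ i\neq j\}$. For $i,j,k\in I_0$ let $P_{\{i,j,k\}}=\{\{i,j\},\{j,k\},\{k,i\},\{i,j*k\},\{j,k*i\},\{k,i*j\}\}\subseteq X_0$. A subset $T\subseteq X_0$ is a generalised nice set if for all $i,j,k\in I_0$, $\{i,j\}\in T$ and $\{i*j,k\}\in T$ imply $P_{\{i,j,k\}}\subseteq T$. A subset $T\subseteq X$ is nice if whenever $\{i,j\},\{i*j,k\}\in T$ for some generative $i,j,k\in I$, then $P_{\{i,j,k\}}\subseteq T$. -}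

module Defs where

open import Level using (0ℓ)
open import Data.Fin using (Fin; zero; suc; #_; _≤_)
open import Data.Fin.Properties using (_≤?_)
import Data.Nat.Properties as ℕ
open import Data.Vec using (Vec; _∷_; []; lookup)
open import Data.Product using (_×_; ∃; ∃-syntax)
open import Data.Sum using (_⊎_)
open import Relation.Nullary using (¬_; yes; no)
open import Relation.Binary.PropositionalEquality using (_≡_; _≢_)
open import Relation.Unary using (Pred; _⊆_)

-- I₀ = {0,…,7} is Fin 8, with the point 0 being `zero`; I = I₀ ∖ {0}.
I₀ : Set
I₀ = Fin 8

-- Multiplication table of the Fano-plane operation * on I₀
-- (lines {1,2,5},{5,6,7},{1,4,7},{1,3,6},{2,4,6},{2,3,7},{3,4,5};
--  0*i = i*0 = i, i*i = 0).
table : Vec (Vec (Fin 8) 8) 8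
table =
    (# 0 ∷ # 1 ∷ # 2 ∷ # 3 ∷ # 4 ∷ # 5 ∷ # 6 ∷ # 7 ∷ [])
  ∷ (# 1 ∷ # 0 ∷ # 5 ∷ # 6 ∷ # 7 ∷ # 2 ∷ # 3 ∷ # 4 ∷ [])
  ∷ (# 2 ∷ # 5 ∷ # 0 ∷ # 7 ∷ # 6 ∷ # 1 ∷ # 4 ∷ # 3 ∷ [])
  ∷ (# 3 ∷ # 6 ∷ # 7 ∷ # 0 ∷ # 5 ∷ # 4 ∷ # 1 ∷ # 2 ∷ [])
  ∷ (# 4 ∷ # 7 ∷ # 6 ∷ # 5 ∷ # 0 ∷ # 3 ∷ # 2 ∷ # 1 ∷ [])
  ∷ (# 5 ∷ # 2 ∷ # 1 ∷ # 4 ∷ # 3 ∷ # 0 ∷ # 7 ∷ # 6 ∷ [])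
  ∷ (# 6 ∷ # 3 ∷ # 4 ∷ # 1 ∷ # 2 ∷ # 7 ∷ # 0 ∷ # 5 ∷ [])
  ∷ (# 7 ∷ # 4 ∷ # 3 ∷ # 2 ∷ # 1 ∷ # 6 ∷ # 5 ∷ # 0 ∷ [])
  ∷ []

infixl 7 _*_
_*_ : I₀ → I₀ → I₀
i * j = lookup (lookup table i) j

-- Unordered pairs {i,j} with i,j ∈ I₀ (i = j allowed), stored canonically
-- with lo ≤ hi.  UPair is the set X₀.
record UPair : Set where
  constructor upair
  field
    lo hi : I₀
    lo≤hi : lo ≤ hi

⦅_,_⦆ : I₀ → I₀ → UPair
⦅ i , j ⦆ with i ≤? j
... | yes p = upair i j p
... | no ¬p = upair j i (ℕ.≰⇒≥ ¬p)

InX : Pred UPair 0ℓ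
InX (upair i j _) = (i ≢ j) × (i ≢ zero) × (j ≢ zero)

P : I₀ → I₀ → I₀ → Pred UPair 0ℓ
P i j k p =
  (p ≡ ⦅ i , j ⦆) ⊎ (p ≡ ⦅ j , k ⦆) ⊎ (p ≡ ⦅ k , i ⦆) ⊎
  (p ≡ ⦅ i , j * k ⦆) ⊎ (p ≡ ⦅ j , k * i ⦆) ⊎ (p ≡ ⦅ k , i * j ⦆)

GeneralisedNice : Pred UPair 0ℓ → Set
GeneralisedNice T =
  ∀ (i j k : I₀) → T ⦅ i , j ⦆ → T ⦅ i * j , k ⦆ → P i j k ⊆ T

Generative : I₀ → I₀ → I₀ → Set
Generative i j k =
  (i ≢ zero) × (j ≢ zero) × (k ≢ zero) ×
  (i ≢ j) × (j ≢ k) × (k ≢ i) × (k ≢ i * j)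

Nice : Pred UPair 0ℓ → Set
Nice T =
  ∀ (i j k : I₀) → Generative i j k →
  T ⦅ i , j ⦆ → T ⦅ i * j , k ⦆ → P i j k ⊆ T

NoBadPair : Pred UPair 0ℓ → Set
NoBadPair T =
  ¬ (∃[ i ] ∃[ j ] ((i ≢ zero) × (j ≢ zero) × (j ≢ i) ×
                    T ⦅ i , j ⦆ × T ⦅ i , i * j ⦆))

{-# OPTIONS --safe #-}
module Submission where

-- If {i,j} and {i*j,k} lie in T ⊆ X, then i, j, k ≠ 0, i ≠ j and k ≠ i*j, so the
-- triple (i,j,k) fails to be generative only when k = i or k = j.  By commutativity
-- of * both degenerate cases are exactly the configurations excluded by (ii); and
-- conversely a generalised nice T cannot contain such a configuration, since for
-- k = i the set P_{i,j,i} contains the diagonal pair {i,i} ∉ X.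

open import Defs
open import Level using (0ℓ)
open import Data.Empty using (⊥-elim)
open import Data.Fin using (zero; _≟_)
open import Data.Fin.Properties using (_≤?_; ≤-antisym; ≤-irrelevant; ≤-total; all?)
open import Data.Product using (_×_; _,_; uncurry)
open import Data.Sum using (inj₁; inj₂; [_,_])
open import Function.Bundles using (_⇔_; mk⇔)
open import Relation.Binary.PropositionalEquality using (_≡_; _≢_; refl; cong; subst; ≢-sym)
open import Relation.Nullary using (yes; no)
open import Relation.Nullary.Decidable using (toWitness)
open import Relation.Unary using (Pred; _⊆_)

*-comm : ∀ i j → i * j ≡ j * i
*-comm = toWitness {a? = all? λ i → all? λ j → i * j ≟ j * i} _

upair-cong : ∀ {i i′ j j′ p q} → i ≡ i′ → j ≡ j′ → upair i j p ≡ upair i′ j′ q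
upair-cong {p = p} {q} refl refl = cong (upair _ _) (≤-irrelevant p q)

⦅⦆-comm : ∀ i j → ⦅ i , j ⦆ ≡ ⦅ j , i ⦆
⦅⦆-comm i j with i ≤? j | j ≤? i
... | yes i≤j | yes j≤i = upair-cong (≤-antisym i≤j j≤i) (≤-antisym j≤i i≤j)
... | yes _   | no  _   = upair-cong refl refl
... | no  _   | yes _   = upair-cong refl refl
... | no  i≰j | no  j≰i = ⊥-elim ([ i≰j , j≰i ] (≤-total i j))

InX-⦅⦆⁻ : ∀ i j → InX ⦅ i , j ⦆ → (i ≢ j) × (i ≢ zero) × (j ≢ zero)
InX-⦅⦆⁻ i j ij∈X with i ≤? j
... | yes _ = ij∈X
... | no  _ = let (j≢i , j≢0 , i≢0) = ij∈X in ≢-sym j≢i , i≢0 , j≢0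

module _ {T : Pred UPair 0ℓ} where

  T-sym : ∀ {i j} → T ⦅ i , j ⦆ → T ⦅ j , i ⦆
  T-sym {i} {j} = subst T (⦅⦆-comm i j)

  generalisedNice⇒nice : GeneralisedNice T → Nice T
  generalisedNice⇒nice gnice i j k _ = gnice i j k

  generalisedNice⇒noBadPair : T ⊆ InX → GeneralisedNice T → NoBadPair T
  generalisedNice⇒noBadPair T⊆X gnice (i , j , _ , _ , _ , ij∈T , i,ij∈T) =
    let (i≢i , _) = InX-⦅⦆⁻ i i (T⊆X ii∈T) in i≢i refl
    where
    ii∈T : T ⦅ i , i ⦆
    ii∈T = gnice i j i ij∈T (T-sym i,ij∈T) (inj₂ (inj₂ (inj₁ refl)))

  nice×noBadPair⇒generalisedNice : T ⊆ InX → Nice T → NoBadPair T → GeneralisedNice T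
  nice×noBadPair⇒generalisedNice T⊆X nice noBadPair i j k ij∈T ij,k∈T
    with InX-⦅⦆⁻ i j (T⊆X ij∈T) | InX-⦅⦆⁻ (i * j) k (T⊆X ij,k∈T) | k ≟ i | k ≟ j
  ... | i≢j , i≢0 , j≢0 | _ | yes refl | _ =
    ⊥-elim (noBadPair (i , j , i≢0 , j≢0 , ≢-sym i≢j , ij∈T , T-sym ij,k∈T))
  ... | i≢j , i≢0 , j≢0 | _ | no _ | yes refl =
    ⊥-elim (noBadPair (j , i , j≢0 , i≢0 , i≢j , T-sym ij∈T , j,ji∈T))
    where
    j,ji∈T : T ⦅ j , j * i ⦆
    j,ji∈T = subst (λ m → T ⦅ j , m ⦆) (*-comm i j) (T-sym ij,k∈T)
  ... | i≢j , i≢0 , j≢0 | ij≢k , _ , k≢0 | no k≢i | no k≢j =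
    nice i j k generative ij∈T ij,k∈T
    where
    generative : Generative i j k
    generative = i≢0 , j≢0 , k≢0 , i≢j , ≢-sym k≢j , k≢i , ≢-sym ij≢k

proposition3p1 : (T : Pred UPair 0ℓ) → T ⊆ InX →
    (GeneralisedNice T ⇔ (Nice T × NoBadPair T))
proposition3p1 T T⊆X = mk⇔
  (λ gnice → generalisedNice⇒nice gnice , generalisedNice⇒noBadPair T⊆X gnice)
  (uncurry (nice×noBadPair⇒generalisedNice T⊆X))
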